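{- Let $G$ be a finite simple graph. Then $m(G)\le 3^{\nu(G)}$, and equality holds if and only if $G\cong sK_3\cup tK_1$, the disjoint union of $s$ triangles and $t$ isolated vertices, where $s=\nu(G)$ and $t=|V(G)|-3s$.
   Context: For a finite simple graph $G$, $m(G)$ denotes the number of maximal independent sets of $G$ (a graph with no edges, including the graph with no vertices, has $m(G)=1$). $\nu(G)$ is the maximum size of a matching (set of pairwise vertex-disjoint edges) of $G$. $K_n$ is the complete graph on $n$ vertices, and $tH$ denotes the disjoint union of $t$ copies of $H$. -}

module Defs where

open import Data.Nat using (ℕ; zero; suc; _+_; _*_; _<_; _/_; _<?_; _≤_) renaming (_≟_ to _≟ℕ_)
open import Data.Bool using (Bool; true; false; _∧_; not)
open import Data.Empty using (⊥-elim)
import Data.Bool.Properties as BoolP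
open import Data.Fin using (Fin; toℕ)
import Data.Fin.Properties as FinP
open import Data.Fin.Subset using (Subset; _∈_; _⊆_)
open import Data.Fin.Subset.Properties using (_∈?_; _⊆?_)
open import Data.Vec using (Vec; []; _∷_)
import Data.Vec.Properties as VecP
open import Data.List using (List; []; _∷_; _++_; map; filter; length; concatMap)
open import Data.List.Membership.Propositional using () renaming (_∈_ to _∈L_)
open import Data.List.Membership.Propositional.Properties using (∈-++⁺ˡ; ∈-++⁺ʳ; ∈-map⁺)
open import Data.List.Relation.Unary.All as All using (All)
open import Data.List.Relation.Unary.Unique.Propositional using (Unique)
open import Data.Product using (Σ; _×_; _,_; proj₁; proj₂)
open import Function.Bundles using (Bijection)
open import Relation.Binary.PropositionalEquality using (_≡_; _≢_; refl; setoid) renaming (sym to ≡-sym)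
open import Relation.Nullary using (Dec; yes; no; ¬_)
open import Relation.Nullary.Decidable using (isYes; _×-dec_; _→-dec_; map′)
open import Relation.Unary using (Pred)

record Graph (n : ℕ) : Set where
  field
    adj    : Fin n → Fin n → Bool
    sym    : ∀ i j → adj i j ≡ adj j i
    irrefl : ∀ i → adj i i ≡ false
open Graph public

_≅_ : ∀ {n m} → Graph n → Graph m → Set
_≅_ {n} {m} G H =
  Σ (Bijection (setoid (Fin n)) (setoid (Fin m))) λ f →
    ∀ i j → adj G i j ≡ adj H (Bijection.to f i) (Bijection.to f j)

Independent : ∀ {n} → Graph n → Subset n → Set
Independent G S = ∀ i j → i ∈ S → j ∈ S → adj G i j ≡ false

MaximalIndependent : ∀ {n} → Graph n → Subset n → Set
MaximalIndependent {n} G S =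
  Independent G S × (∀ (T : Subset n) → Independent G T → S ⊆ T → T ≡ S)

allSubsets : ∀ n → List (Subset n)
allSubsets zero    = [] ∷ []
allSubsets (suc n) = map (true ∷_) (allSubsets n) ++ map (false ∷_) (allSubsets n)

allSubsets-complete : ∀ {n} (S : Subset n) → S ∈L allSubsets n
allSubsets-complete []          = Data.List.Relation.Unary.Any.here refl
  where import Data.List.Relation.Unary.Any
allSubsets-complete (true ∷ S)  = ∈-++⁺ˡ (∈-map⁺ (true ∷_) (allSubsets-complete S))
allSubsets-complete {suc n} (false ∷ S) =
  ∈-++⁺ʳ (map (true ∷_) (allSubsets n)) (∈-map⁺ (false ∷_) (allSubsets-complete S))

∀Subset? : ∀ {n} {P : Pred (Subset n) Agda.Primitive.lzero} →
           (∀ S → Dec (P S)) → Dec (∀ S → P S)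
∀Subset? {n} P? =
  map′ (λ a S → All.lookup a (allSubsets-complete S))
       (λ f → All.tabulate (λ {S} _ → f S))
       (All.all? P? (allSubsets n))

independent? : ∀ {n} (G : Graph n) (S : Subset n) → Dec (Independent G S)
independent? G S =
  FinP.all? λ i → FinP.all? λ j →
    (i ∈? S) →-dec ((j ∈? S) →-dec (adj G i j BoolP.≟ false))

maximalIndependent? : ∀ {n} (G : Graph n) (S : Subset n) →
                      Dec (MaximalIndependent G S)
maximalIndependent? G S =
  independent? G S ×-dec
  ∀Subset? (λ T → independent? G T →-dec
                   ((S ⊆? T) →-dec VecP.≡-dec BoolP._≟_ T S))

m : ∀ {n} → Graph n → ℕ
m {n} G = length (filter (maximalIndependent? G) (allSubsets n))

-- a matching: a list of edges whose endpoints are pairwise distinct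
-- (so the edges are pairwise vertex-disjoint and pairwise distinct)
endpoints : ∀ {n} → List (Fin n × Fin n) → List (Fin n)
endpoints = concatMap (λ e → proj₁ e ∷ proj₂ e ∷ [])

IsMatching : ∀ {n} → Graph n → List (Fin n × Fin n) → Set
IsMatching G M = All (λ e → adj G (proj₁ e) (proj₂ e) ≡ true) M
               × Unique (endpoints M)

IsMatchingNumber : ∀ {n} → Graph n → ℕ → Set
IsMatchingNumber G k =
  Σ _ (λ M → IsMatching G M × length M ≡ k)
  × (∀ M → IsMatching G M → length M ≤ k)

-- s K₃ ∪ t K₁ on vertex set Fin (3 * s + t):
-- vertices 0..3s-1 form the triangles {3i,3i+1,3i+2}; the rest are isolated

sK₃∪tK₁-adj : ∀ s t → Fin (3 * s + t) → Fin (3 * s + t) → Bool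
sK₃∪tK₁-adj s t i j =
  isYes (toℕ i <? 3 * s) ∧ isYes (toℕ j <? 3 * s)
  ∧ not (isYes (i FinP.≟ j)) ∧ isYes (toℕ i / 3 ≟ℕ toℕ j / 3)

sK₃∪tK₁-sym : ∀ s t i j → sK₃∪tK₁-adj s t i j ≡ sK₃∪tK₁-adj s t j i
sK₃∪tK₁-sym s t i j with toℕ i <? 3 * s | toℕ j <? 3 * s
  | i FinP.≟ j | j FinP.≟ i | toℕ i / 3 ≟ℕ toℕ j / 3 | toℕ j / 3 ≟ℕ toℕ i / 3
... | no _  | no _  | _ | _ | _ | _ = refl
... | no _  | yes _ | _ | _ | _ | _ = refl
... | yes _ | no _  | _ | _ | _ | _ = refl
... | yes _ | yes _ | yes _ | yes _ | _ | _ = refl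
... | yes _ | yes _ | yes p | no q | _ | _ = ⊥-elim (q (≡-sym p))
... | yes _ | yes _ | no p | yes q | _ | _ = ⊥-elim (p (≡-sym q))
... | yes _ | yes _ | no _ | no _ | yes _ | yes _ = refl
... | yes _ | yes _ | no _ | no _ | no _ | no _ = refl
... | yes _ | yes _ | no _ | no _ | yes p | no q = ⊥-elim (q (≡-sym p))
... | yes _ | yes _ | no _ | no _ | no p | yes q = ⊥-elim (p (≡-sym q))

sK₃∪tK₁-irrefl : ∀ s t i → sK₃∪tK₁-adj s t i i ≡ false
sK₃∪tK₁-irrefl s t i with toℕ i <? 3 * s | i FinP.≟ i
... | no _  | _     = refl
... | yes _ | yes _ = refl
... | yes _ | no p  = ⊥-elim (p refl)

sK₃∪tK₁ : ∀ s t → Graph (3 * s + t)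
sK₃∪tK₁ s t = record
  { adj = sK₃∪tK₁-adj s t ; sym = sK₃∪tK₁-sym s t ; irrefl = sK₃∪tK₁-irrefl s t }

module Submission where

-- Fix a maximum matching M with matched vertices V.  Unmatched vertices are
-- pairwise non-adjacent, so a maximal independent set S is the extension of
-- S ∩ V (add every unmatched vertex without neighbour in S ∩ V), and S ∩ V
-- contains at most one end of each edge of M, i.e. it is coded by a word in
-- {0,1,2}^ν.  Hence m(G) ≤ 3^ν (MaximumMatching.upper-bound).
-- If m(G) = 3^ν, counting shows that EVERY coded selection extends to a
-- maximal independent set.  Applied to ∅, to singletons and to pairs this
-- forces (module Extremal) each edge of M to span a triangle with its own
-- unmatched apex, and no other edges: a TriangleDecomposition.  Such a
-- decomposition amounts to an isomorphism with νK₃ ∪ tK₁ (FromTriangles,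
-- Coordinates, pull-back) and yields 3^ν maximal independent sets, one corner
-- per triangle (Triangles.lower-bound).

open import Data.Nat using (ℕ; _≤_; _^_; _*_; _∸_)
open import Data.Product using (_×_)
open import Function.Bundles using (_⇔_)
open import Relation.Binary.PropositionalEquality using (_≡_)

open import Defs renaming (sym to adj-sym)

open import Data.Nat using (zero; suc; _+_; _<_; _<?_; _/_; _%_; z≤n) renaming (_≟_ to _ℕ≟_)
import Data.Nat.Properties as ℕP
open import Data.Nat.DivMod
  using ( +-distrib-/-∣ʳ; m<n⇒m/n≡0; m*n/n≡m; [m+kn]%n≡m%n; m<n⇒m%n≡m; /-congˡ; %-congˡ
        ; m<n*o⇒m/o<n; m%n<n; m≡m%n+[m/n]*n )
open import Data.Nat.Divisibility using (divides)
open import Data.Bool using (Bool; true; false; not; _∧_)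
import Data.Bool.Properties as BoolP
open import Data.Empty using (⊥-elim) renaming (⊥ to Empty)
open import Data.Product using (_,_; proj₁; proj₂; ∃)
import Data.Product
open import Data.Sum using (_⊎_; inj₁; inj₂; [_,_]′)
open import Function using (_∘_)
open import Function.Bundles using (Bijection; mk⇔; mk⤖; mk↔ₛ′)

open import Data.Fin using (Fin; zero; suc; toℕ; fromℕ<; _↑ʳ_)
import Data.Fin.Properties as FinP
open import Data.Fin.Permutation using (↔⇒≡)
open import Data.Fin.Subset using (Subset; _∈_; _∉_; ⁅_⁆; _∪_) renaming (⊥ to ∅)
open import Data.Fin.Subset.Properties
  using (_∈?_; ⊆-antisym; ∉⊥; x∈⁅x⁆; x∈⁅y⁆⇒x≡y; x∈p∪q⁺; x∈p∪q⁻; q⊆p∪q)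
open import Data.Vec using (Vec; []; _∷_; tabulate)
import Data.Vec as Vec
import Data.Vec.Properties as VecP

open import Data.List using (List; []; _∷_; _++_; map; filter; length; removeAt; allFin)
import Data.List as List
import Data.List.Properties as ListP
open import Data.List.Membership.Propositional using () renaming (_∈_ to _∈L_; _∉_ to _∉L_)
open import Data.List.Membership.Propositional.Properties
  using (∈-filter⁺; ∈-filter⁻; ∈-map⁺; ∈-map⁻; ∈-++⁺ˡ; ∈-++⁺ʳ; ∈-++⁻; ∈-lookup; ∈-allFin)
import Data.List.Membership.DecPropositional as DecMembership
open import Data.List.Relation.Binary.Subset.Propositional using () renaming (_⊆_ to _⊆L_)
open import Data.List.Relation.Unary.Any using (here; there)
import Data.List.Relation.Unary.Any as Any
import Data.List.Relation.Unary.Any.Properties as AnyP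
open import Data.List.Relation.Unary.All as All using (All; []; _∷_)
import Data.List.Relation.Unary.All.Properties as AllP
open import Data.List.Relation.Unary.AllPairs using ([]; _∷_)
open import Data.List.Relation.Unary.Unique.Propositional using (Unique)
import Data.List.Relation.Unary.Unique.Propositional.Properties as UniqueP
open import Data.List.Relation.Binary.Permutation.Propositional
  using (_↭_; ↭-refl; ↭-prep; ↭-trans; ↭-sym; ↭⇒↭ₛ)
import Data.List.Relation.Binary.Permutation.Propositional.Properties as PermProp
import Data.List.Relation.Binary.Permutation.Setoid.Properties as PermSetoid

open import Relation.Binary.Definitions using (DecidableEquality)
open import Relation.Binary.PropositionalEquality
  using (_≢_; refl; sym; trans; cong; cong₂; subst; setoid; module ≡-Reasoning)
open import Relation.Nullary using (Dec; yes; no; does; ¬_)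
open import Relation.Nullary.Decidable
  using (dec-true; dec-false; isYes; isYes≗does; _×-dec_; _⊎-dec_; _→-dec_; ¬?)

does⇒ : ∀ {P : Set} (d : Dec P) → does d ≡ true → P
does⇒ (yes p) _ = p

bool-clash : ∀ {A : Set} → true ≡ false → A
bool-clash ()

setOf : ∀ {n} {P : Fin n → Set} → (∀ i → Dec (P i)) → Subset n
setOf P? = tabulate (λ i → does (P? i))

∈setOf⁺ : ∀ {n} {P : Fin n → Set} (P? : ∀ i → Dec (P i)) {i} → P i → i ∈ setOf P?
∈setOf⁺ P? {i} p =
  VecP.lookup⇒[]= i _ (trans (VecP.lookup∘tabulate _ i) (dec-true (P? i) p))

∈setOf⁻ : ∀ {n} {P : Fin n → Set} (P? : ∀ i → Dec (P i)) {i} → i ∈ setOf P? → P i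
∈setOf⁻ P? {i} i∈ =
  does⇒ (P? i) (trans (sym (VecP.lookup∘tabulate _ i)) (VecP.[]=⇒lookup i∈))

insert-decomposition : ∀ {n} {T R : Subset n} {x} → x ∈ T →
  (∀ {i} → i ∈ R → i ∈ T) → (∀ {i} → i ∈ T → i ≢ x → i ∈ R) → T ≡ ⁅ x ⁆ ∪ R
insert-decomposition {R = R} {x} x∈T R⊆T rest = ⊆-antisym into back
  where
  into : ∀ {i} → i ∈ _ → i ∈ ⁅ x ⁆ ∪ R
  into {i} i∈T with i FinP.≟ x
  ... | yes refl = x∈p∪q⁺ (inj₁ (x∈⁅x⁆ x))
  ... | no i≢x   = x∈p∪q⁺ (inj₂ (rest i∈T i≢x))
  back : ∀ {i} → i ∈ ⁅ x ⁆ ∪ R → i ∈ _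
  back i∈ with x∈p∪q⁻ ⁅ x ⁆ R i∈
  ... | inj₁ i∈⁅x⁆ = subst (_∈ _) (sym (x∈⁅y⁆⇒x≡y x i∈⁅x⁆)) x∈T
  ... | inj₂ i∈R   = R⊆T i∈R

∈pair⁻ : ∀ {n} {x y i : Fin n} → i ∈ ⁅ x ⁆ ∪ ⁅ y ⁆ → i ≡ x ⊎ i ≡ y
∈pair⁻ {x = x} {y} = Data.Sum.map (x∈⁅y⁆⇒x≡y x) (x∈⁅y⁆⇒x≡y y) ∘ x∈p∪q⁻ ⁅ x ⁆ ⁅ y ⁆

subset-≟ : ∀ {n} → DecidableEquality (Subset n)
subset-≟ = VecP.≡-dec BoolP._≟_

module Counting {A : Set} (_≟_ : DecidableEquality A) where

  private
    delete : A → List A → List A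
    delete x = filter (λ y → ¬? (x ≟ y))

    delete-shorter : ∀ {x ys} → x ∈L ys → length (delete x ys) < length ys
    delete-shorter {x} {ys} x∈ =
      ListP.filter-notAll _ ys (Any.map (λ x≡ x≢ → x≢ x≡) x∈)

    delete-keeps : ∀ {x y ys} → y ∈L ys → x ≢ y → y ∈L delete x ys
    delete-keeps y∈ x≢y = ∈-filter⁺ _ y∈ x≢y

  unique-⊆⇒length≤ : ∀ {xs ys : List A} → Unique xs → xs ⊆L ys → length xs ≤ length ys
  unique-⊆⇒length≤ {[]}     _               _   = z≤n
  unique-⊆⇒length≤ {x ∷ xs} u@(_ ∷ uxs) sub =
    ℕP.≤-<-trans (unique-⊆⇒length≤ uxs (λ z∈ → delete-keeps (sub (there z∈)) (x∉ z∈)))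
                 (delete-shorter (sub (here refl)))
    where
    x∉ : ∀ {z} → z ∈L xs → x ≢ z
    x∉ z∈ refl = UniqueP.Unique[x∷xs]⇒x∉xs u z∈

  unique-⊂⇒length< : ∀ {xs ys : List A} {y} → Unique xs → xs ⊆L ys → y ∈L ys → y ∉L xs →
                     length xs < length ys
  unique-⊂⇒length< u sub y∈ y∉ =
    ℕP.≤-<-trans (unique-⊆⇒length≤ u (λ z∈ → delete-keeps (sub z∈) (λ { refl → y∉ z∈ })))
                 (delete-shorter y∈)

Code : ℕ → Set
Code = Vec (Fin 3)

allCodes : ∀ k → List (Code k)
allCodes zero    = [] ∷ []
allCodes (suc k) = block zero ++ block (suc zero) ++ block (suc (suc zero))
  where block = λ r → map (r ∷_) (allCodes k)

allCodes-complete : ∀ {k} (c : Code k) → c ∈L allCodes k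
allCodes-complete []                           = here refl
allCodes-complete {suc k} (zero ∷ c)           = ∈-++⁺ˡ (∈-map⁺ _ (allCodes-complete c))
allCodes-complete {suc k} (suc zero ∷ c)       =
  ∈-++⁺ʳ (map _ (allCodes k)) (∈-++⁺ˡ (∈-map⁺ _ (allCodes-complete c)))
allCodes-complete {suc k} (suc (suc zero) ∷ c) =
  ∈-++⁺ʳ (map _ (allCodes k)) (∈-++⁺ʳ (map _ (allCodes k)) (∈-map⁺ _ (allCodes-complete c)))

allCodes-unique : ∀ k → Unique (allCodes k)
allCodes-unique zero    = [] ∷ []
allCodes-unique (suc k) =
  UniqueP.++⁺ (block-unique zero)
    (UniqueP.++⁺ (block-unique (suc zero)) (block-unique (suc (suc zero))) (heads-differ λ ()))
    λ (v∈₀ , v∈₁₂) → [ heads-differ (λ ()) ∘ (v∈₀ ,_) , heads-differ (λ ()) ∘ (v∈₀ ,_) ]′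
                       (∈-++⁻ (map _ (allCodes k)) v∈₁₂)
  where
  block-unique : ∀ r → Unique (map (r ∷_) (allCodes k))
  block-unique r = UniqueP.map⁺ VecP.∷-injectiveʳ (allCodes-unique k)
  heads-differ : ∀ {r r' : Fin 3} {v} → r ≢ r' →
                 ¬ (v ∈L map (r ∷_) (allCodes k) × v ∈L map (r' ∷_) (allCodes k))
  heads-differ r≢r' (v∈ , v∈') with ∈-map⁻ _ v∈ | ∈-map⁻ _ v∈'
  ... | _ , _ , refl | _ , _ , eq = r≢r' (VecP.∷-injectiveˡ eq)

length-allCodes : ∀ k → length (allCodes k) ≡ 3 ^ k
length-allCodes zero    = refl
length-allCodes (suc k) = begin
  length (block zero ++ block (suc zero) ++ block (suc (suc zero)))
    ≡⟨ ListP.length-++ (block zero) ⟩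
  length (block zero) + length (block (suc zero) ++ block (suc (suc zero)))
    ≡⟨ cong (length (block zero) +_) (ListP.length-++ (block (suc zero))) ⟩
  length (block zero) + (length (block (suc zero)) + length (block (suc (suc zero))))
    ≡⟨ cong₂ _+_ (length-block zero) (cong₂ _+_ (length-block (suc zero)) (length-block (suc (suc zero)))) ⟩
  3 ^ k + (3 ^ k + 3 ^ k)
    ≡⟨ cong (λ x → 3 ^ k + (3 ^ k + x)) (sym (ℕP.+-identityʳ (3 ^ k))) ⟩
  3 ^ suc k ∎
  where
  open ≡-Reasoning
  block = λ (r : Fin 3) → map (r ∷_) (allCodes k)
  length-block : ∀ r → length (block r) ≡ 3 ^ k
  length-block r = trans (ListP.length-map _ (allCodes k)) (length-allCodes k)

endpoint : ∀ {n} (E : List (Fin n × Fin n)) → Fin (length E) → Bool → Fin n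
endpoint ((a , _) ∷ _) zero    true  = a
endpoint ((_ , b) ∷ _) zero    false = b
endpoint (_ ∷ E)       (suc k) side  = endpoint E k side

endpoint∈endpoints : ∀ {n} (E : List (Fin n × Fin n)) k side → endpoint E k side ∈L endpoints E
endpoint∈endpoints (_ ∷ _) zero    true  = here refl
endpoint∈endpoints (_ ∷ _) zero    false = there (here refl)
endpoint∈endpoints (_ ∷ E) (suc k) side  = there (there (endpoint∈endpoints E k side))

∈endpoints⇒endpoint : ∀ {n} (E : List (Fin n × Fin n)) {x} → x ∈L endpoints E →
                      ∃ λ k → ∃ λ side → x ≡ endpoint E k side
∈endpoints⇒endpoint (_ ∷ _) (here x≡)         = zero , true , x≡
∈endpoints⇒endpoint (_ ∷ _) (there (here x≡)) = zero , false , x≡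
∈endpoints⇒endpoint (_ ∷ E) (there (there x∈)) with ∈endpoints⇒endpoint E x∈
... | k , side , x≡ = suc k , side , x≡

head-fresh : ∀ {n} {e} {E : List (Fin n × Fin n)} {x} → Unique (endpoints (e ∷ E)) →
             ∀ side → x ∈L endpoints E → endpoint (e ∷ E) zero side ≢ x
head-fresh ((_ ∷ a∉) ∷ _) true  x∈ = All.lookup a∉ x∈
head-fresh (_ ∷ b∉ ∷ _)   false x∈ = All.lookup b∉ x∈

endpoint-injective : ∀ {n} {E : List (Fin n × Fin n)} → Unique (endpoints E) →
  ∀ {k k' side side'} → endpoint E k side ≡ endpoint E k' side' → k ≡ k' × side ≡ side'
endpoint-injective {E = _ ∷ _} _ {zero} {zero} {true}  {true}  _ = refl , refl
endpoint-injective {E = _ ∷ _} _ {zero} {zero} {false} {false} _ = refl , refl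
endpoint-injective {E = _ ∷ _} ((a≢b ∷ _) ∷ _) {zero} {zero} {true}  {false} a≡b = ⊥-elim (a≢b a≡b)
endpoint-injective {E = _ ∷ _} ((a≢b ∷ _) ∷ _) {zero} {zero} {false} {true}  b≡a = ⊥-elim (a≢b (sym b≡a))
endpoint-injective {E = _ ∷ E} u {zero} {suc k'} {side} {side'} eq =
  ⊥-elim (head-fresh u side (endpoint∈endpoints E k' side') eq)
endpoint-injective {E = _ ∷ E} u {suc k} {zero} {side} {side'} eq =
  ⊥-elim (head-fresh u side' (endpoint∈endpoints E k side) (sym eq))
endpoint-injective {E = _ ∷ E} (_ ∷ _ ∷ u) {suc k} {suc k'} {side} {side'} eq
  with endpoint-injective {E = E} u {k} {k'} {side} {side'} eq
... | refl , side≡ = refl , side≡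

-- Selections are exactly the sets `selected E c`,
-- where the code c says, for each edge, whether neither, the first or the second
-- end is taken.
IsSelection : ∀ {n} → List (Fin n × Fin n) → Subset n → Set
IsSelection E T = (∀ {i} → i ∈ T → i ∈L endpoints E)
                × (∀ k → ¬ (endpoint E k true ∈ T × endpoint E k false ∈ T))

selected : ∀ {n} (E : List (Fin n × Fin n)) → Code (length E) → Subset n
selected []            []                   = ∅
selected (_ ∷ E)       (zero ∷ c)           = selected E c
selected ((a , _) ∷ E) (suc zero ∷ c)       = ⁅ a ⁆ ∪ selected E c
selected ((_ , b) ∷ E) (suc (suc zero) ∷ c) = ⁅ b ⁆ ∪ selected E c

selection-has-code : ∀ {n} (E : List (Fin n × Fin n)) {T} → IsSelection E T →
                     ∃ λ c → T ≡ selected E c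
selection-has-code [] (inE , _) =
  [] , ⊆-antisym (λ i∈ → ⊥-elim (AnyP.¬Any[] (inE i∈))) (λ i∈ → ⊥-elim (∉⊥ i∈))
selection-has-code ((a , b) ∷ E) {T} (inE , atMostOne) =
  choose (selection-has-code E (inE-R , λ k → atMostOne (suc k) ∘ Data.Product.map R⊆T R⊆T))
         (a ∈? T) (b ∈? T)
  where
  R? = λ i → (i ∈? T) ×-dec (¬? (i FinP.≟ a) ×-dec ¬? (i FinP.≟ b))
  R = setOf R?
  R⊆T : ∀ {i} → i ∈ R → i ∈ T
  R⊆T i∈ = proj₁ (∈setOf⁻ R? i∈)
  R⁺ : ∀ {i} → i ∈ T → i ≢ a → i ≢ b → i ∈ R
  R⁺ i∈ i≢a i≢b = ∈setOf⁺ R? (i∈ , i≢a , i≢b)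
  inE-R : ∀ {i} → i ∈ R → i ∈L endpoints E
  inE-R i∈ with ∈setOf⁻ R? i∈
  ... | i∈T , i≢a , i≢b with inE i∈T
  ...   | here i≡a          = ⊥-elim (i≢a i≡a)
  ...   | there (here i≡b)  = ⊥-elim (i≢b i≡b)
  ...   | there (there i∈E) = i∈E
  choose : (∃ λ c → R ≡ selected E c) → Dec (a ∈ T) → Dec (b ∈ T) →
           ∃ λ c → T ≡ selected ((a , b) ∷ E) c
  choose _       (yes a∈) (yes b∈) = ⊥-elim (atMostOne zero (a∈ , b∈))
  choose (c , R≡) (yes a∈) (no b∉) =
    suc zero ∷ c ,
    trans (insert-decomposition a∈ R⊆T (λ i∈ i≢a → R⁺ i∈ i≢a λ { refl → b∉ i∈ })) (cong (⁅ a ⁆ ∪_) R≡)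
  choose (c , R≡) (no a∉) (yes b∈) =
    suc (suc zero) ∷ c ,
    trans (insert-decomposition b∈ R⊆T (λ i∈ i≢b → R⁺ i∈ (λ { refl → a∉ i∈ }) i≢b)) (cong (⁅ b ⁆ ∪_) R≡)
  choose (c , R≡) (no a∉) (no b∉) =
    zero ∷ c ,
    trans (⊆-antisym (λ i∈ → R⁺ i∈ (λ { refl → a∉ i∈ }) (λ { refl → b∉ i∈ })) R⊆T) R≡

endpoints-removeAt : ∀ {n} (E : List (Fin n × Fin n)) k →
  endpoints E ↭ endpoint E k true ∷ endpoint E k false ∷ endpoints (removeAt E k)
endpoints-removeAt (_ ∷ _)       zero    = ↭-refl
endpoints-removeAt ((a , b) ∷ E) (suc k) =
  ↭-trans (↭-prep a (↭-prep b (endpoints-removeAt E k)))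
          (PermProp.shifts (a ∷ b ∷ []) (endpoint E k true ∷ endpoint E k false ∷ []))

All-removeAt : ∀ {A : Set} {P : A → Set} {xs : List A} → All P xs → ∀ k → All P (removeAt xs k)
All-removeAt (_ ∷ ps)  zero    = ps
All-removeAt (p ∷ ps)  (suc k) = p ∷ All-removeAt ps k

unique-resp-↭ : ∀ {A : Set} {xs ys : List A} → xs ↭ ys → Unique xs → Unique ys
unique-resp-↭ {A} xs↭ys = PermSetoid.Unique-resp-↭ (setoid A) (↭⇒↭ₛ xs↭ys)

maximalSets : ∀ {n} → Graph n → List (Subset n)
maximalSets {n} G = filter (maximalIndependent? G) (allSubsets n)

allSubsets-unique : ∀ n → Unique (allSubsets n)
allSubsets-unique zero    = [] ∷ []
allSubsets-unique (suc n) =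
  UniqueP.++⁺ (UniqueP.map⁺ VecP.∷-injectiveʳ (allSubsets-unique n))
              (UniqueP.map⁺ VecP.∷-injectiveʳ (allSubsets-unique n))
              λ (S∈ , S∈') → heads-differ (∈-map⁻ _ S∈) (∈-map⁻ _ S∈')
  where
  heads-differ : ∀ {S : Subset (suc n)} → (∃ λ T → T ∈L allSubsets n × S ≡ true ∷ T) →
                 (∃ λ T → T ∈L allSubsets n × S ≡ false ∷ T) → Empty
  heads-differ (_ , _ , refl) (_ , _ , ())

maximalSets-unique : ∀ {n} (G : Graph n) → Unique (maximalSets G)
maximalSets-unique {n} G = UniqueP.filter⁺ (maximalIndependent? G) (allSubsets-unique n)

maximalSets⁺ : ∀ {n} (G : Graph n) {S} → MaximalIndependent G S → S ∈L maximalSets G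
maximalSets⁺ G {S} = ∈-filter⁺ (maximalIndependent? G) (allSubsets-complete S)

maximalSets⁻ : ∀ {n} (G : Graph n) {S} → S ∈L maximalSets G → MaximalIndependent G S
maximalSets⁻ {n} G S∈ = proj₂ (∈-filter⁻ (maximalIndependent? G) {xs = allSubsets n} S∈)

module SubsetCounting {n : ℕ} = Counting (subset-≟ {n})

module _ {n : ℕ} (G : Graph n) where

  adj⇒≢ : ∀ {i j} → adj G i j ≡ true → i ≢ j
  adj⇒≢ {i} i~j refl = bool-clash (trans (sym i~j) (irrefl G i))

  adj-flip : ∀ {i j} → adj G i j ≡ true → adj G j i ≡ true
  adj-flip {i} {j} = trans (adj-sym G j i)

  -- A maximal independent set dominates G: every vertex outside it has a neighbour in it,
  -- for otherwise the vertex could be added.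
  maximal⇒dominating : ∀ {S} → MaximalIndependent G S →
                       ∀ {i} → i ∉ S → ∃ λ j → j ∈ S × adj G i j ≡ true
  maximal⇒dominating {S} (indep , maximal) {i} i∉S
    with FinP.any? (λ j → (j ∈? S) ×-dec (adj G i j BoolP.≟ true))
  ... | yes dominated  = dominated
  ... | no undominated =
    ⊥-elim (i∉S (subst (i ∈_) (maximal (⁅ i ⁆ ∪ S) indep⁺ (q⊆p∪q ⁅ i ⁆ S)) (x∈p∪q⁺ (inj₁ (x∈⁅x⁆ i)))))
    where
    free : ∀ {j} → j ∈ S → adj G i j ≡ false
    free j∈S = BoolP.¬-not (λ i~j → undominated (_ , j∈S , i~j))
    indep⁺ : Independent G (⁅ i ⁆ ∪ S)
    indep⁺ k l k∈ l∈ with x∈p∪q⁻ ⁅ i ⁆ S k∈ | x∈p∪q⁻ ⁅ i ⁆ S l∈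
    ... | inj₁ k∈⁅i⁆ | inj₁ l∈⁅i⁆
      rewrite x∈⁅y⁆⇒x≡y i k∈⁅i⁆ | x∈⁅y⁆⇒x≡y i l∈⁅i⁆ = irrefl G i
    ... | inj₁ k∈⁅i⁆ | inj₂ l∈S rewrite x∈⁅y⁆⇒x≡y i k∈⁅i⁆ = free l∈S
    ... | inj₂ k∈S   | inj₁ l∈⁅i⁆ rewrite x∈⁅y⁆⇒x≡y i l∈⁅i⁆ = trans (adj-sym G k i) (free k∈S)
    ... | inj₂ k∈S   | inj₂ l∈S = indep k l k∈S l∈S

  edges-adjacent : ∀ {E} → All (λ e → adj G (proj₁ e) (proj₂ e) ≡ true) E →
                   ∀ k → adj G (endpoint E k true) (endpoint E k false) ≡ true
  edges-adjacent (e~ ∷ _)  zero    = e~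
  edges-adjacent (_ ∷ es)  (suc k) = edges-adjacent es k

module MaximumMatching {n : ℕ} (G : Graph n) (M : List (Fin n × Fin n))
                       (M-matching : IsMatching G M)
                       (M-maximum : ∀ M' → IsMatching G M' → length M' ≤ length M) where

  V : List (Fin n)
  V = endpoints M

  _∈V? : ∀ i → Dec (i ∈L V)
  i ∈V? = DecMembership._∈?_ FinP._≟_ i V

  u v : Fin (length M) → Fin n
  u k = endpoint M k true
  v k = endpoint M k false

  V-unique : Unique V
  V-unique = proj₂ M-matching

  u~v : ∀ k → adj G (u k) (v k) ≡ true
  u~v = edges-adjacent G (proj₁ M-matching)

  -- An edge between two unmatched vertices could be added to M.
  unmatched-nonadjacent : ∀ {i j} → i ∉L V → j ∉L V → adj G i j ≡ false
  unmatched-nonadjacent {i} {j} i∉ j∉ = BoolP.¬-not λ i~j →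
    ℕP.<-irrefl refl (M-maximum ((i , j) ∷ M)
      (i~j ∷ proj₁ M-matching ,
       (adj⇒≢ G i~j ∷ AllP.¬Any⇒All¬ _ i∉) ∷ AllP.¬Any⇒All¬ _ j∉ ∷ V-unique))

  -- There is no augmenting path y — u k — v k — z through two distinct unmatched
  -- vertices: trading the edge u k v k for y u k and v k z would enlarge M.
  no-augmenting-path : ∀ k {y z} → y ∉L V → z ∉L V →
                       adj G (u k) y ≡ true → adj G (v k) z ≡ true → y ≡ z
  no-augmenting-path k {y} {z} y∉ z∉ u~y v~z with y FinP.≟ z
  ... | yes y≡z = y≡z
  ... | no  y≢z = ⊥-elim (ℕP.<-irrefl (sym (ListP.length-removeAt′ M k)) (M-maximum M′ (edges , unique)))
    where
    R  = endpoints (removeAt M k)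
    M′ = (y , u k) ∷ (v k , z) ∷ removeAt M k
    edges : All (λ e → adj G (proj₁ e) (proj₂ e) ≡ true) M′
    edges = adj-flip G u~y ∷ v~z ∷ All-removeAt (proj₁ M-matching) k
    uv-front : V ↭ u k ∷ v k ∷ R
    uv-front = endpoints-removeAt M k
    fresh : ∀ {x} → x ∉L V → All (x ≢_) (u k ∷ v k ∷ R)
    fresh x∉ = AllP.¬Any⇒All¬ _ (x∉ ∘ PermProp.Any-resp-↭ (↭-sym uv-front))
    unique : Unique (endpoints M′)
    unique = unique-resp-↭ (↭-prep y (↭-sym (PermProp.shift z (u k ∷ v k ∷ []) R)))
               ((y≢z ∷ fresh y∉) ∷ fresh z∉ ∷ unique-resp-↭ uv-front V-unique)

  Extension : Subset n → Fin n → Set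
  Extension p i = i ∈ p ⊎ (i ∉L V × (∀ j → j ∈ p → adj G i j ≡ false))

  extension? : ∀ p i → Dec (Extension p i)
  extension? p i =
    (i ∈? p) ⊎-dec (¬? (i ∈V?) ×-dec FinP.all? λ j → (j ∈? p) →-dec (adj G i j BoolP.≟ false))

  extend : Subset n → Subset n
  extend p = setOf (extension? p)

  extend⁺ : ∀ {p i} → Extension p i → i ∈ extend p
  extend⁺ {p} = ∈setOf⁺ (extension? p)

  extend⁻ : ∀ {p i} → i ∈ extend p → Extension p i
  extend⁻ {p} = ∈setOf⁻ (extension? p)

  extend-matched : ∀ {p x} → x ∈L V → x ∈ extend p → x ∈ p
  extend-matched x∈V x∈ with extend⁻ x∈
  ... | inj₁ x∈p      = x∈p
  ... | inj₂ (x∉V , _) = ⊥-elim (x∉V x∈V)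

  matchedPart? : ∀ S i → Dec (i ∈ S × i ∈L V)
  matchedPart? S i = (i ∈? S) ×-dec (i ∈V?)

  matchedPart : Subset n → Subset n
  matchedPart S = setOf (matchedPart? S)

  maximal-is-extension : ∀ {S} → MaximalIndependent G S → S ≡ extend (matchedPart S)
  maximal-is-extension {S} S-max@(indep , _) = ⊆-antisym into back
    where
    into : ∀ {i} → i ∈ S → i ∈ extend (matchedPart S)
    into {i} i∈S with i ∈V?
    ... | yes i∈V = extend⁺ (inj₁ (∈setOf⁺ (matchedPart? S) (i∈S , i∈V)))
    ... | no  i∉V = extend⁺ (inj₂ (i∉V , λ j j∈ → indep i j i∈S (proj₁ (∈setOf⁻ (matchedPart? S) j∈))))
    unmatched-in-S : ∀ {i} → i ∉L V → (∀ j → j ∈ matchedPart S → adj G i j ≡ false) → i ∈ S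
    unmatched-in-S {i} i∉V free with i ∈? S
    ... | yes i∈S = i∈S
    ... | no  i∉S with maximal⇒dominating G S-max i∉S
    ...   | j , j∈S , i~j with j ∈V?
    ...     | yes j∈V = bool-clash (trans (sym i~j) (free j (∈setOf⁺ (matchedPart? S) (j∈S , j∈V))))
    ...     | no  j∉V = bool-clash (trans (sym i~j) (unmatched-nonadjacent i∉V j∉V))
    back : ∀ {i} → i ∈ extend (matchedPart S) → i ∈ S
    back i∈ with extend⁻ i∈
    ... | inj₁ i∈S∩V        = proj₁ (∈setOf⁻ (matchedPart? S) i∈S∩V)
    ... | inj₂ (i∉V , free) = unmatched-in-S i∉V free

  matched-selection : ∀ {S} → Independent G S → IsSelection M (matchedPart S)
  matched-selection {S} indep =
    proj₂ ∘ ∈setOf⁻ (matchedPart? S) ,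
    λ k (u∈ , v∈) → bool-clash (trans (sym (u~v k))
      (indep _ _ (proj₁ (∈setOf⁻ (matchedPart? S) u∈)) (proj₁ (∈setOf⁻ (matchedPart? S) v∈))))

  maximal-has-code : ∀ {S} → MaximalIndependent G S → ∃ λ c → S ≡ extend (selected M c)
  maximal-has-code S-max@(indep , _) with selection-has-code M (matched-selection indep)
  ... | c , S∩V≡ = c , trans (maximal-is-extension S-max) (cong extend S∩V≡)

  codeSets : List (Subset n)
  codeSets = map (extend ∘ selected M) (allCodes (length M))

  maximalSets⊆codeSets : maximalSets G ⊆L codeSets
  maximalSets⊆codeSets S∈ with maximal-has-code (maximalSets⁻ G S∈)
  ... | c , S≡ = subst (_∈L codeSets) (sym S≡) (∈-map⁺ _ (allCodes-complete c))

  length-codeSets : length codeSets ≡ 3 ^ length M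
  length-codeSets = trans (ListP.length-map _ (allCodes (length M))) (length-allCodes (length M))

  upper-bound : m G ≤ 3 ^ length M
  upper-bound = subst (m G ≤_) length-codeSets
    (SubsetCounting.unique-⊆⇒length≤ (maximalSets-unique G) maximalSets⊆codeSets)

-- This is an isomorphism
-- G ≅ sK₃ ∪ tK₁ with the triangles and their corners labelled.
record TriangleDecomposition {n : ℕ} (G : Graph n) (s : ℕ) : Set where
  field
    corner           : Fin s → Fin 3 → Fin n
    corner-injective : ∀ {k r k' r'} → corner k r ≡ corner k' r' → k ≡ k' × r ≡ r'
    within           : ∀ k {r r'} → r ≢ r' → adj G (corner k r) (corner k r') ≡ true
    across           : ∀ {k k'} r r' → k ≢ k' → adj G (corner k r) (corner k' r') ≡ false
    isolated         : ∀ x → (∀ k r → corner k r ≢ x) → ∀ y → adj G x y ≡ false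

module Extremal {n : ℕ} (G : Graph n) (M : List (Fin n × Fin n))
                (M-matching : IsMatching G M)
                (M-maximum : ∀ M' → IsMatching G M' → length M' ≤ length M)
                (extremal : m G ≡ 3 ^ length M) where

  open MaximumMatching G M M-matching M-maximum

  -- Equality in the counting argument: the extension of every selection is maximal.
  selection-extension-maximal : ∀ {T} → IsSelection M T → MaximalIndependent G (extend T)
  selection-extension-maximal {T} T-sel with DecMembership._∈?_ subset-≟ (extend T) (maximalSets G)
  ... | yes T∈ = maximalSets⁻ G T∈
  ... | no  T∉ = ⊥-elim (ℕP.<-irrefl (trans extremal (sym length-codeSets))
                   (SubsetCounting.unique-⊂⇒length< (maximalSets-unique G)
                                                   maximalSets⊆codeSets T∈codeSets T∉))
    where
    T∈codeSets : extend T ∈L codeSets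
    T∈codeSets with selection-has-code M T-sel
    ... | c , T≡ = subst (λ X → extend X ∈L codeSets) (sym T≡) (∈-map⁺ _ (allCodes-complete c))

  edge-of : ∀ {k k' side side'} → endpoint M k side ≡ endpoint M k' side' → k ≡ k'
  edge-of eq = proj₁ (endpoint-injective {E = M} V-unique eq)

  side-of : ∀ {k k' side side'} → endpoint M k side ≡ endpoint M k' side' → side ≡ side'
  side-of eq = proj₂ (endpoint-injective {E = M} V-unique eq)

  -- Matched vertices are adjacent only along M: two adjacent ends x, y of
  -- different edges would form a selection whose extension is not independent.
  same-edge : ∀ {k k' side side'} → adj G (endpoint M k side) (endpoint M k' side') ≡ true → k ≡ k'
  same-edge {k} {k'} {side} {side'} x~y with k FinP.≟ k'
  ... | yes k≡k' = k≡k'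
  ... | no  k≢k' = bool-clash (trans (sym x~y)
          (proj₁ (selection-extension-maximal (inV , one-end)) _ _
                 (extend⁺ (inj₁ (x∈p∪q⁺ (inj₁ (x∈⁅x⁆ _))))) (extend⁺ (inj₁ (x∈p∪q⁺ (inj₂ (x∈⁅x⁆ _)))))))
    where
    x = endpoint M k side
    y = endpoint M k' side'
    inV : ∀ {i} → i ∈ ⁅ x ⁆ ∪ ⁅ y ⁆ → i ∈L V
    inV i∈ with ∈pair⁻ i∈
    ... | inj₁ refl = endpoint∈endpoints M k side
    ... | inj₂ refl = endpoint∈endpoints M k' side'
    one-end : ∀ j → ¬ (u j ∈ ⁅ x ⁆ ∪ ⁅ y ⁆ × v j ∈ ⁅ x ⁆ ∪ ⁅ y ⁆)
    one-end j (uj∈ , vj∈) with ∈pair⁻ uj∈ | ∈pair⁻ vj∈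
    ... | inj₁ uj≡x | inj₁ vj≡x = adj⇒≢ G (u~v j) (trans uj≡x (sym vj≡x))
    ... | inj₁ uj≡x | inj₂ vj≡y = k≢k' (trans (sym (edge-of uj≡x)) (edge-of vj≡y))
    ... | inj₂ uj≡y | inj₁ vj≡x = k≢k' (trans (sym (edge-of vj≡x)) (edge-of uj≡y))
    ... | inj₂ uj≡y | inj₂ vj≡y = adj⇒≢ G (u~v j) (trans uj≡y (sym vj≡y))

  -- Every matched vertex x has an unmatched neighbour: the extension of ∅ (the
  -- set of unmatched vertices) is maximal and does not contain x.
  unmatched-neighbour : ∀ {x} → x ∈L V → ∃ λ w → w ∉L V × adj G x w ≡ true
  unmatched-neighbour {x} x∈V = neighbour (maximal⇒dominating G ∅-maximal (∉⊥ ∘ extend-matched x∈V))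
    where
    ∅-maximal : MaximalIndependent G (extend ∅)
    ∅-maximal = selection-extension-maximal ((⊥-elim ∘ ∉⊥) , λ _ → ∉⊥ ∘ proj₁)
    neighbour : (∃ λ w → w ∈ extend ∅ × adj G x w ≡ true) → ∃ λ w → w ∉L V × adj G x w ≡ true
    neighbour (w , w∈ , x~w) with extend⁻ w∈
    ... | inj₁ w∈∅       = ⊥-elim (∉⊥ w∈∅)
    ... | inj₂ (w∉V , _) = w , w∉V , x~w

  -- The apex of the k-th edge: an unmatched neighbour of u k.  Only the two
  -- properties below are used, so the choice is kept abstract.
  abstract
    apex : Fin (length M) → Fin n
    apex k = proj₁ (unmatched-neighbour (endpoint∈endpoints M k true))

    apex-unmatched : ∀ k → apex k ∉L V
    apex-unmatched k = proj₁ (proj₂ (unmatched-neighbour (endpoint∈endpoints M k true)))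

    u~apex : ∀ k → adj G (u k) (apex k) ≡ true
    u~apex k = proj₂ (proj₂ (unmatched-neighbour (endpoint∈endpoints M k true)))

  -- The apex is the only unmatched neighbour of either end of its edge, since
  -- M admits no augmenting path (and v k does have some unmatched neighbour).
  apex-unique : ∀ k side {y} → y ∉L V → adj G (endpoint M k side) y ≡ true → y ≡ apex k
  apex-unique k true y∉V u~y with unmatched-neighbour (endpoint∈endpoints M k false)
  ... | z , z∉V , v~z = trans (no-augmenting-path k y∉V z∉V u~y v~z)
                              (sym (no-augmenting-path k (apex-unmatched k) z∉V (u~apex k) v~z))
  apex-unique k false y∉V v~y = sym (no-augmenting-path k (apex-unmatched k) y∉V (u~apex k) v~y)

  v~apex : ∀ k → adj G (v k) (apex k) ≡ true
  v~apex k with unmatched-neighbour (endpoint∈endpoints M k false)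
  ... | z , z∉V , v~z = subst (λ z → adj G (v k) z ≡ true) (apex-unique k false z∉V v~z) v~z

  apex-not-matched : ∀ k side k' → endpoint M k side ≢ apex k'
  apex-not-matched k side k' eq = apex-unmatched k' (subst (_∈L V) eq (endpoint∈endpoints M k side))

  -- Different edges have different apexes: the extension of {u k} is maximal, so
  -- it dominates u k'; the dominating vertex can be neither u k (same-edge) nor
  -- an unmatched vertex (it would be the common apex, adjacent to u k).
  apex-injective : ∀ {k k'} → apex k ≡ apex k' → k ≡ k'
  apex-injective {k} {k'} apexes≡ with k FinP.≟ k'
  ... | yes k≡k' = k≡k'
  ... | no  k≢k' = ⊥-elim (not-dominated (maximal⇒dominating G ⁅u⁆-maximal u'∉))
    where
    ⁅u⁆-maximal : MaximalIndependent G (extend ⁅ u k ⁆)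
    ⁅u⁆-maximal = selection-extension-maximal
      ( (λ i∈ → subst (_∈L V) (sym (x∈⁅y⁆⇒x≡y _ i∈)) (endpoint∈endpoints M k true))
      , λ j (uj∈ , vj∈) → adj⇒≢ G (u~v j) (trans (x∈⁅y⁆⇒x≡y _ uj∈) (sym (x∈⁅y⁆⇒x≡y _ vj∈))) )
    u'∉ : u k' ∉ extend ⁅ u k ⁆
    u'∉ u'∈ = k≢k' (sym (edge-of (x∈⁅y⁆⇒x≡y _ (extend-matched (endpoint∈endpoints M k' true) u'∈))))
    not-dominated : ¬ (∃ λ z → z ∈ extend ⁅ u k ⁆ × adj G (u k') z ≡ true)
    not-dominated (z , z∈ , u'~z) with extend⁻ z∈
    ... | inj₁ z∈⁅u⁆ =
      k≢k' (sym (same-edge (subst (λ t → adj G (u k') t ≡ true) (x∈⁅y⁆⇒x≡y _ z∈⁅u⁆) u'~z)))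
    ... | inj₂ (z∉V , free) = bool-clash (trans (sym (adj-flip G (u~apex k)))
                                (subst (λ t → adj G t (u k) ≡ false) z≡apex (free (u k) (x∈⁅x⁆ (u k)))))
      where
      z≡apex : z ≡ apex k
      z≡apex = trans (apex-unique k' true z∉V u'~z) (sym apexes≡)

  corner : Fin (length M) → Fin 3 → Fin n
  corner k zero             = u k
  corner k (suc zero)       = v k
  corner k (suc (suc zero)) = apex k

  corner-injective : ∀ {k r k' r'} → corner k r ≡ corner k' r' → k ≡ k' × r ≡ r'
  corner-injective {k} {zero}           {k'} {zero}           eq = edge-of eq , refl
  corner-injective {k} {zero}           {k'} {suc zero}       eq = bool-clash (side-of eq)
  corner-injective {k} {suc zero}       {k'} {zero}           eq = bool-clash (sym (side-of eq))
  corner-injective {k} {suc zero}       {k'} {suc zero}       eq = edge-of eq , refl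
  corner-injective {k} {zero}           {k'} {suc (suc zero)} eq = ⊥-elim (apex-not-matched k true k' eq)
  corner-injective {k} {suc zero}       {k'} {suc (suc zero)} eq = ⊥-elim (apex-not-matched k false k' eq)
  corner-injective {k} {suc (suc zero)} {k'} {zero}           eq = ⊥-elim (apex-not-matched k' true k (sym eq))
  corner-injective {k} {suc (suc zero)} {k'} {suc zero}       eq = ⊥-elim (apex-not-matched k' false k (sym eq))
  corner-injective {k} {suc (suc zero)} {k'} {suc (suc zero)} eq = apex-injective eq , refl

  within : ∀ k {r r'} → r ≢ r' → adj G (corner k r) (corner k r') ≡ true
  within k {zero}           {zero}           r≢r' = ⊥-elim (r≢r' refl)
  within k {zero}           {suc zero}       _    = u~v k
  within k {zero}           {suc (suc zero)} _    = u~apex k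
  within k {suc zero}       {zero}           _    = adj-flip G (u~v k)
  within k {suc zero}       {suc zero}       r≢r' = ⊥-elim (r≢r' refl)
  within k {suc zero}       {suc (suc zero)} _    = v~apex k
  within k {suc (suc zero)} {zero}           _    = adj-flip G (u~apex k)
  within k {suc (suc zero)} {suc zero}       _    = adj-flip G (v~apex k)
  within k {suc (suc zero)} {suc (suc zero)} r≢r' = ⊥-elim (r≢r' refl)

  ends-apart : ∀ {k k'} side side' → k ≢ k' → adj G (endpoint M k side) (endpoint M k' side') ≡ false
  ends-apart _ _ k≢k' = BoolP.¬-not (k≢k' ∘ same-edge)

  end-apex-apart : ∀ {k k'} side → k ≢ k' → adj G (endpoint M k side) (apex k') ≡ false
  end-apex-apart {k} {k'} side k≢k' =
    BoolP.¬-not λ x~apex → k≢k' (sym (apex-injective (apex-unique k side (apex-unmatched k') x~apex)))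

  apex-end-apart : ∀ {k k'} side → k ≢ k' → adj G (apex k) (endpoint M k' side) ≡ false
  apex-end-apart {k} {k'} side k≢k' = trans (adj-sym G (apex k) _) (end-apex-apart side (k≢k' ∘ sym))

  across : ∀ {k k'} r r' → k ≢ k' → adj G (corner k r) (corner k' r') ≡ false
  across zero             zero             = ends-apart true true
  across zero             (suc zero)       = ends-apart true false
  across (suc zero)       zero             = ends-apart false true
  across (suc zero)       (suc zero)       = ends-apart false false
  across zero             (suc (suc zero)) = end-apex-apart true
  across (suc zero)       (suc (suc zero)) = end-apex-apart false
  across (suc (suc zero)) zero             = apex-end-apart true
  across (suc (suc zero)) (suc zero)       = apex-end-apart false
  across {k} {k'} (suc (suc zero)) (suc (suc zero)) _ =
    unmatched-nonadjacent (apex-unmatched k) (apex-unmatched k')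

  non-corner-unmatched : ∀ {x} → (∀ k r → corner k r ≢ x) → x ∉L V
  non-corner-unmatched not-corner x∈V with ∈endpoints⇒endpoint M x∈V
  ... | k , true  , x≡ = not-corner k zero (sym x≡)
  ... | k , false , x≡ = not-corner k (suc zero) (sym x≡)

  -- A vertex that is no corner is unmatched, and is adjacent neither to a
  -- matched vertex (it would be an apex) nor to an unmatched one.
  isolated : ∀ x → (∀ k r → corner k r ≢ x) → ∀ y → adj G x y ≡ false
  isolated x not-corner y with y ∈V?
  ... | no  y∉V = unmatched-nonadjacent (non-corner-unmatched not-corner) y∉V
  ... | yes y∈V with ∈endpoints⇒endpoint M y∈V
  ...   | k , side , refl = BoolP.¬-not λ x~y → not-corner k (suc (suc zero))
            (sym (apex-unique k side (non-corner-unmatched not-corner) (adj-flip G x~y)))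

  triangles : TriangleDecomposition G (length M)
  triangles = record
    { corner = corner ; corner-injective = corner-injective
    ; within = within ; across = across ; isolated = isolated }

module Triangles {n : ℕ} {G : Graph n} {s : ℕ} (T : TriangleDecomposition G s) where
  open TriangleDecomposition T

  IsCorner : Fin n → Set
  IsCorner i = ∃ λ k → ∃ λ r → corner k r ≡ i

  isCorner? : ∀ i → Dec (IsCorner i)
  isCorner? i = FinP.any? λ k → FinP.any? λ r → corner k r FinP.≟ i

  non-corner : ∀ {i} → ¬ IsCorner i → ∀ k r → corner k r ≢ i
  non-corner ¬corner k r eq = ¬corner (k , r , eq)

  Transversal : Code s → Fin n → Set
  Transversal c i = (∃ λ k → corner k (Vec.lookup c k) ≡ i) ⊎ ¬ IsCorner i

  transversal? : ∀ c i → Dec (Transversal c i)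
  transversal? c i = FinP.any? (λ k → corner k (Vec.lookup c k) FinP.≟ i) ⊎-dec ¬? (isCorner? i)

  transversal : Code s → Subset n
  transversal c = setOf (transversal? c)

  transversal-independent : ∀ c → Independent G (transversal c)
  transversal-independent c i j i∈ j∈ =
    nonadjacent (∈setOf⁻ (transversal? c) i∈) (∈setOf⁻ (transversal? c) j∈)
    where
    nonadjacent : Transversal c i → Transversal c j → adj G i j ≡ false
    nonadjacent (inj₂ i-isolated) _ = isolated i (non-corner i-isolated) j
    nonadjacent (inj₁ _) (inj₂ j-isolated) = trans (adj-sym G i j) (isolated j (non-corner j-isolated) i)
    nonadjacent (inj₁ (k , refl)) (inj₁ (k' , refl)) with k FinP.≟ k'
    ... | yes refl = irrefl G _
    ... | no  k≢k' = across _ _ k≢k'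

  -- An independent superset cannot contain another corner, since it is adjacent
  -- to the chosen corner of its triangle.
  transversal-maximal : ∀ c → MaximalIndependent G (transversal c)
  transversal-maximal c =
    transversal-independent c , λ S indep ⊇ → ⊆-antisym (within-transversal S indep ⊇) ⊇
    where
    within-transversal : ∀ S → Independent G S → (∀ {i} → i ∈ transversal c → i ∈ S) →
                         ∀ {i} → i ∈ S → i ∈ transversal c
    within-transversal S indep ⊇ {i} i∈S with isCorner? i
    ... | no  ¬corner = ∈setOf⁺ (transversal? c) (inj₂ ¬corner)
    ... | yes (k , r , refl) with r FinP.≟ Vec.lookup c k
    ...   | yes refl = ∈setOf⁺ (transversal? c) (inj₁ (k , refl))
    ...   | no  r≢ck = bool-clash (trans (sym (within k r≢ck))
                         (indep _ _ i∈S (⊇ (∈setOf⁺ (transversal? c) (inj₁ (k , refl))))))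

  transversal-injective : ∀ {c c'} → transversal c ≡ transversal c' → c ≡ c'
  transversal-injective {c} {c'} c≡c' =
    trans (sym (VecP.tabulate∘lookup c)) (trans (VecP.tabulate-cong same-letter) (VecP.tabulate∘lookup c'))
    where
    letter : ∀ k → Transversal c' (corner k (Vec.lookup c k)) → Vec.lookup c k ≡ Vec.lookup c' k
    letter k (inj₁ (_ , eq)) with corner-injective eq
    ... | refl , c'k≡ck = sym c'k≡ck
    letter k (inj₂ ¬corner) = ⊥-elim (¬corner (k , _ , refl))
    same-letter : ∀ k → Vec.lookup c k ≡ Vec.lookup c' k
    same-letter k = letter k (∈setOf⁻ (transversal? c')
      (subst (corner k (Vec.lookup c k) ∈_) c≡c' (∈setOf⁺ (transversal? c) (inj₁ (k , refl)))))

  lower-bound : 3 ^ s ≤ m G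
  lower-bound = subst (_≤ m G) (trans (ListP.length-map transversal (allCodes s)) (length-allCodes s))
    (SubsetCounting.unique-⊆⇒length≤ (UniqueP.map⁺ transversal-injective (allCodes-unique s)) transversals⊆)
    where
    transversals⊆ : map transversal (allCodes s) ⊆L maximalSets G
    transversals⊆ S∈ with ∈-map⁻ transversal S∈
    ... | c , _ , refl = maximalSets⁺ G (transversal-maximal c)

quotient-of-position : ∀ k r → r < 3 → (r + k * 3) / 3 ≡ k
quotient-of-position k r r<3 = begin
  (r + k * 3) / 3   ≡⟨ +-distrib-/-∣ʳ r (divides k refl) ⟩
  r / 3 + k * 3 / 3 ≡⟨ cong₂ _+_ (m<n⇒m/n≡0 r<3) (m*n/n≡m k 3) ⟩
  k                 ∎
  where open ≡-Reasoning

remainder-of-position : ∀ k r → r < 3 → (r + k * 3) % 3 ≡ r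
remainder-of-position k r r<3 = trans ([m+kn]%n≡m%n r k 3) (m<n⇒m%n≡m r<3)

isYes-true : ∀ {P : Set} (d : Dec P) → P → isYes d ≡ true
isYes-true d p = trans (isYes≗does d) (dec-true d p)

isYes-false : ∀ {P : Set} (d : Dec P) → ¬ P → isYes d ≡ false
isYes-false d ¬p = trans (isYes≗does d) (dec-false d ¬p)

∧-false-last : ∀ a b c → a ∧ (b ∧ (c ∧ false)) ≡ false
∧-false-last a b c rewrite BoolP.∧-zeroʳ c | BoolP.∧-zeroʳ b | BoolP.∧-zeroʳ a = refl

-- Coordinates on sK₃ ∪ tK₁: vertex r + 3k (k < s, r < 3) is corner r of
-- triangle k, and the vertices from 3s on are the isolated ones.
module Coordinates (s t : ℕ) where

  H : Graph (3 * s + t)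
  H = sK₃∪tK₁ s t

  adj-H-within : ∀ {a b} → toℕ a < 3 * s → toℕ b < 3 * s → a ≢ b → toℕ a / 3 ≡ toℕ b / 3 →
                 adj H a b ≡ true
  adj-H-within {a} {b} a< b< a≢b same-triangle
    rewrite isYes-true (toℕ a <? 3 * s) a< | isYes-true (toℕ b <? 3 * s) b<
          | isYes-false (a FinP.≟ b) a≢b | isYes-true (toℕ a / 3 ℕ≟ toℕ b / 3) same-triangle = refl

  adj-H-across : ∀ {a b} → toℕ a / 3 ≢ toℕ b / 3 → adj H a b ≡ false
  adj-H-across {a} {b} different-triangles
    rewrite isYes-false (toℕ a / 3 ℕ≟ toℕ b / 3) different-triangles =
    ∧-false-last (isYes (toℕ a <? 3 * s)) (isYes (toℕ b <? 3 * s)) (not (isYes (a FinP.≟ b)))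

  adj-H-isolated : ∀ {a b} → ¬ toℕ a < 3 * s → adj H a b ≡ false
  adj-H-isolated {a} a≥ rewrite isYes-false (toℕ a <? 3 * s) a≥ = refl

  position< : ∀ (k : Fin s) (r : Fin 3) → toℕ r + toℕ k * 3 < 3 * s
  position< k r = begin-strict
    toℕ r + toℕ k * 3 <⟨ ℕP.+-monoˡ-< (toℕ k * 3) (FinP.toℕ<n r) ⟩
    3 + toℕ k * 3     ≤⟨ ℕP.*-monoˡ-≤ 3 (FinP.toℕ<n k) ⟩
    s * 3             ≡⟨ ℕP.*-comm s 3 ⟩
    3 * s             ∎
    where open ℕP.≤-Reasoning

  vertex : Fin s → Fin 3 → Fin (3 * s + t)
  vertex k r = fromℕ< (ℕP.<-≤-trans (position< k r) (ℕP.m≤m+n (3 * s) t))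

  toℕ-vertex : ∀ k r → toℕ (vertex k r) ≡ toℕ r + toℕ k * 3
  toℕ-vertex k r = FinP.toℕ-fromℕ< _

  vertex-below : ∀ k r → toℕ (vertex k r) < 3 * s
  vertex-below k r = subst (_< 3 * s) (sym (toℕ-vertex k r)) (position< k r)

  vertex-triangle : ∀ k r → toℕ (vertex k r) / 3 ≡ toℕ k
  vertex-triangle k r = trans (/-congˡ (toℕ-vertex k r)) (quotient-of-position (toℕ k) (toℕ r) (FinP.toℕ<n r))

  vertex-corner : ∀ k r → toℕ (vertex k r) % 3 ≡ toℕ r
  vertex-corner k r = trans (%-congˡ (toℕ-vertex k r)) (remainder-of-position (toℕ k) (toℕ r) (FinP.toℕ<n r))

  vertex-injective : ∀ {k r k' r'} → vertex k r ≡ vertex k' r' → k ≡ k' × r ≡ r'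
  vertex-injective {k} {r} {k'} {r'} eq =
    FinP.toℕ-injective (trans (sym (vertex-triangle k r))
                              (trans (cong (λ a → toℕ a / 3) eq) (vertex-triangle k' r'))) ,
    FinP.toℕ-injective (trans (sym (vertex-corner k r))
                              (trans (cong (λ a → toℕ a % 3) eq) (vertex-corner k' r')))

  triangleOf : ∀ {a : Fin (3 * s + t)} → toℕ a < 3 * s → Fin s
  triangleOf {a} a< = fromℕ< (m<n*o⇒m/o<n (subst (toℕ a <_) (ℕP.*-comm 3 s) a<))

  cornerOf : Fin (3 * s + t) → Fin 3
  cornerOf a = fromℕ< (m%n<n (toℕ a) 3)

  toℕ-triangleOf : ∀ {a} (a< : toℕ a < 3 * s) → toℕ (triangleOf a<) ≡ toℕ a / 3
  toℕ-triangleOf {a} a< = FinP.toℕ-fromℕ< (m<n*o⇒m/o<n (subst (toℕ a <_) (ℕP.*-comm 3 s) a<))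

  toℕ-cornerOf : ∀ a → toℕ (cornerOf a) ≡ toℕ a % 3
  toℕ-cornerOf a = FinP.toℕ-fromℕ< (m%n<n (toℕ a) 3)

  vertex-coordinates : ∀ {a} (a< : toℕ a < 3 * s) → vertex (triangleOf a<) (cornerOf a) ≡ a
  vertex-coordinates {a} a< = FinP.toℕ-injective (begin
    toℕ (vertex (triangleOf a<) (cornerOf a))
      ≡⟨ toℕ-vertex (triangleOf a<) (cornerOf a) ⟩
    toℕ (cornerOf a) + toℕ (triangleOf a<) * 3
      ≡⟨ cong₂ (λ r k → r + k * 3) (toℕ-cornerOf a) (toℕ-triangleOf a<) ⟩
    toℕ a % 3 + toℕ a / 3 * 3
      ≡⟨ sym (m≡m%n+[m/n]*n (toℕ a) 3) ⟩
    toℕ a ∎)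
    where open ≡-Reasoning

  decomposition : TriangleDecomposition H s
  decomposition = record
    { corner = vertex ; corner-injective = vertex-injective
    ; within = within ; across = across ; isolated = isolated }
    where
    within : ∀ k {r r'} → r ≢ r' → adj H (vertex k r) (vertex k r') ≡ true
    within k {r} {r'} r≢r' = adj-H-within (vertex-below k r) (vertex-below k r')
      (r≢r' ∘ proj₂ ∘ vertex-injective {k} {r} {k} {r'})
      (trans (vertex-triangle k r) (sym (vertex-triangle k r')))
    across : ∀ {k k'} r r' → k ≢ k' → adj H (vertex k r) (vertex k' r') ≡ false
    across {k} {k'} r r' k≢k' = adj-H-across λ same →
      k≢k' (FinP.toℕ-injective (trans (sym (vertex-triangle k r)) (trans same (vertex-triangle k' r'))))
    isolated : ∀ x → (∀ k r → vertex k r ≢ x) → ∀ y → adj H x y ≡ false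
    isolated x not-vertex y =
      adj-H-isolated {x} {y} (λ x< → not-vertex (triangleOf x<) (cornerOf x) (vertex-coordinates x<))

pull-back : ∀ {n N} {G : Graph n} {H : Graph N} {s} → G ≅ H → TriangleDecomposition H s →
            TriangleDecomposition G s
pull-back {n} {N} {G} {H} (f , preserves) TH = record
  { corner = λ k r → from (TH.corner k r)
  ; corner-injective = λ eq → TH.corner-injective (trans (sym (to-from _)) (trans (cong to eq) (to-from _)))
  ; within = λ k r≢r' → trans (adj-from _ _) (TH.within k r≢r')
  ; across = λ r r' k≢k' → trans (adj-from _ _) (TH.across r r' k≢k')
  ; isolated = λ x not-corner y → trans (preserves x y)
      (TH.isolated (to x) (λ k r eq → not-corner k r (trans (cong from eq) (from-to x))) (to y))
  }
  where
  module TH = TriangleDecomposition TH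
  to = Bijection.to f
  from : Fin N → Fin n
  from y = proj₁ (Bijection.surjective f y)
  to-from : ∀ y → to (from y) ≡ y
  to-from y = proj₂ (Bijection.surjective f y) refl
  from-to : ∀ x → from (to x) ≡ x
  from-to x = Bijection.injective f (to-from (to x))
  adj-from : ∀ a b → adj G (from a) (from b) ≡ adj H a b
  adj-from a b = trans (preserves (from a) (from b)) (cong₂ (adj H) (to-from a) (to-from b))

corners-agree : ∀ {n N s} {G : Graph n} {H : Graph N}
  (TG : TriangleDecomposition G s) (TH : TriangleDecomposition H s) → ∀ k r k' r' →
  adj G (TriangleDecomposition.corner TG k r) (TriangleDecomposition.corner TG k' r') ≡
  adj H (TriangleDecomposition.corner TH k r) (TriangleDecomposition.corner TH k' r')
corners-agree {G = G} {H} TG TH k r k' r' with k FinP.≟ k' | r FinP.≟ r'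
... | yes refl | yes refl = trans (irrefl G _) (sym (irrefl H _))
... | yes refl | no r≢r'  = trans (TG.within k r≢r') (sym (TH.within k r≢r'))
  where module TG = TriangleDecomposition TG
        module TH = TriangleDecomposition TH
... | no k≢k'  | _        = trans (TG.across r r' k≢k') (sym (TH.across r r' k≢k'))
  where module TG = TriangleDecomposition TG
        module TH = TriangleDecomposition TH

lookup-unique-injective : ∀ {A : Set} {xs : List A} → Unique xs →
                          ∀ {i j} → List.lookup xs i ≡ List.lookup xs j → i ≡ j
lookup-unique-injective {xs = _ ∷ _} _         {zero}  {zero}  _  = refl
lookup-unique-injective {xs = _ ∷ _} (x∉ ∷ _)  {zero}  {suc j} eq = ⊥-elim (All.lookup x∉ (∈-lookup j) eq)
lookup-unique-injective {xs = _ ∷ _} (x∉ ∷ _)  {suc i} {zero}  eq = ⊥-elim (All.lookup x∉ (∈-lookup i) (sym eq))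
lookup-unique-injective {xs = _ ∷ _} (_ ∷ u)   {suc i} {suc j} eq = cong suc (lookup-unique-injective u eq)

-- A triangle decomposition of G with s triangles gives G ≅ sK₃ ∪ tK₁: corner r
-- of triangle k corresponds to vertex r + 3k, and the non-corners, listed in
-- increasing order, to the vertices 3s, 3s + 1, … .
module FromTriangles {n : ℕ} {G : Graph n} {s : ℕ} (T : TriangleDecomposition G s) where
  open TriangleDecomposition T
  open Triangles T using (IsCorner; isCorner?)

  outside : List (Fin n)
  outside = filter (¬? ∘ isCorner?) (allFin n)

  outside-unique : Unique outside
  outside-unique = UniqueP.filter⁺ (¬? ∘ isCorner?) (UniqueP.allFin⁺ n)

  outside-isolated : ∀ i → ¬ IsCorner (List.lookup outside i)
  outside-isolated i = proj₂ (∈-filter⁻ (¬? ∘ isCorner?) {xs = allFin n} (∈-lookup i))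

  t : ℕ
  t = length outside

  open Coordinates s t

  offset-position : ∀ {a : Fin (3 * s + t)} → ¬ toℕ a < 3 * s → 3 * s + (toℕ a ∸ 3 * s) ≡ toℕ a
  offset-position a≥ = ℕP.m+[n∸m]≡n (ℕP.≮⇒≥ a≥)

  offset< : ∀ {a : Fin (3 * s + t)} → ¬ toℕ a < 3 * s → toℕ a ∸ 3 * s < t
  offset< {a} a≥ = ℕP.+-cancelˡ-< (3 * s) _ _ (subst (_< 3 * s + t) (sym (offset-position a≥)) (FinP.toℕ<n a))

  φ-by : (a : Fin (3 * s + t)) → Dec (toℕ a < 3 * s) → Fin n
  φ-by a (yes a<) = corner (triangleOf a<) (cornerOf a)
  φ-by a (no  a≥) = List.lookup outside (fromℕ< (offset< a≥))

  φ : Fin (3 * s + t) → Fin n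
  φ a = φ-by a (toℕ a <? 3 * s)

  φ-preserves : ∀ a b → adj G (φ a) (φ b) ≡ adj H a b
  φ-preserves a b = by (toℕ a <? 3 * s) (toℕ b <? 3 * s)
    where
    by : ∀ da db → adj G (φ-by a da) (φ-by b db) ≡ adj H a b
    by (yes a<) (yes b<) = trans (corners-agree T decomposition _ _ _ _)
                                 (cong₂ (adj H) (vertex-coordinates a<) (vertex-coordinates b<))
    by (no  a≥) _        = trans (isolated _ (λ k r eq → outside-isolated _ (k , r , eq)) _)
                                 (sym (adj-H-isolated a≥))
    by (yes a<) (no b≥)  = trans (adj-sym G _ _) (trans (isolated _ (λ k r eq → outside-isolated _ (k , r , eq)) _)
                                 (sym (trans (adj-sym H a b) (adj-H-isolated b≥))))

  φ-injective : ∀ {a b} → φ a ≡ φ b → a ≡ b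
  φ-injective {a} {b} = by (toℕ a <? 3 * s) (toℕ b <? 3 * s)
    where
    by : ∀ da db → φ-by a da ≡ φ-by b db → a ≡ b
    by (yes a<) (yes b<) eq with corner-injective eq
    ... | k≡ , r≡ = trans (sym (vertex-coordinates a<)) (trans (cong₂ vertex k≡ r≡) (vertex-coordinates b<))
    by (yes a<) (no b≥)  eq = ⊥-elim (outside-isolated _ (_ , _ , eq))
    by (no a≥)  (yes b<) eq = ⊥-elim (outside-isolated _ (_ , _ , sym eq))
    by (no a≥)  (no b≥)  eq = FinP.toℕ-injective (begin
      toℕ a                     ≡⟨ sym (offset-position a≥) ⟩
      3 * s + (toℕ a ∸ 3 * s)   ≡⟨ cong (3 * s +_) offsets≡ ⟩
      3 * s + (toℕ b ∸ 3 * s)   ≡⟨ offset-position b≥ ⟩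
      toℕ b                     ∎)
      where
      open ≡-Reasoning
      offsets≡ : toℕ a ∸ 3 * s ≡ toℕ b ∸ 3 * s
      offsets≡ = trans (sym (FinP.toℕ-fromℕ< (offset< a≥)))
                 (trans (cong toℕ (lookup-unique-injective outside-unique eq)) (FinP.toℕ-fromℕ< (offset< b≥)))

  φ-surjective : ∀ x → ∃ λ a → φ a ≡ x
  φ-surjective x with isCorner? x
  ... | yes (k , r , refl) = vertex k r , by (toℕ (vertex k r) <? 3 * s)
    where
    by : ∀ d → φ-by (vertex k r) d ≡ corner k r
    by (yes a<) = cong₂ corner
      (FinP.toℕ-injective (trans (toℕ-triangleOf a<) (vertex-triangle k r)))
      (FinP.toℕ-injective (trans (toℕ-cornerOf (vertex k r)) (vertex-corner k r)))
    by (no a≥)  = ⊥-elim (a≥ (vertex-below k r))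
  ... | no ¬corner = a , by (toℕ a <? 3 * s)
    where
    x∈ : x ∈L outside
    x∈ = ∈-filter⁺ (¬? ∘ isCorner?) (∈-allFin x) ¬corner
    i : Fin t
    i = Any.index x∈
    a : Fin (3 * s + t)
    a = 3 * s ↑ʳ i
    toℕ-a : toℕ a ≡ 3 * s + toℕ i
    toℕ-a = FinP.toℕ-↑ʳ (3 * s) i
    by : ∀ d → φ-by a d ≡ x
    by (yes a<) = ⊥-elim (ℕP.<⇒≱ a< (subst (3 * s ≤_) (sym toℕ-a) (ℕP.m≤m+n _ _)))
    by (no a≥)  = trans (cong (List.lookup outside) (FinP.toℕ-injective (begin
        toℕ (fromℕ< (offset< a≥)) ≡⟨ FinP.toℕ-fromℕ< (offset< a≥) ⟩
        toℕ a ∸ 3 * s             ≡⟨ cong (_∸ 3 * s) toℕ-a ⟩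
        3 * s + toℕ i ∸ 3 * s     ≡⟨ ℕP.m+n∸m≡n (3 * s) (toℕ i) ⟩
        toℕ i                     ∎)))
      (sym (AnyP.lookup-index x∈))
      where open ≡-Reasoning

  ψ : Fin n → Fin (3 * s + t)
  ψ x = proj₁ (φ-surjective x)

  φ∘ψ : ∀ x → φ (ψ x) ≡ x
  φ∘ψ x = proj₂ (φ-surjective x)

  ψ∘φ : ∀ a → ψ (φ a) ≡ a
  ψ∘φ a = φ-injective (φ∘ψ (φ a))

  vertex-count : 3 * s + t ≡ n
  vertex-count = ↔⇒≡ (mk↔ₛ′ φ ψ φ∘ψ ψ∘φ)

  isomorphism : G ≅ sK₃∪tK₁ s (n ∸ 3 * s)
  isomorphism = subst (λ t′ → G ≅ sK₃∪tK₁ s t′)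
    (trans (sym (ℕP.m+n∸m≡n (3 * s) t)) (cong (_∸ 3 * s) vertex-count))
    ( mk⤖ ((λ {x} {y} ψx≡ψy → trans (sym (φ∘ψ x)) (trans (cong φ ψx≡ψy) (φ∘ψ y))) ,
           (λ a → φ a , λ {x} x≡φa → trans (cong ψ x≡φa) (ψ∘φ a)))
    , λ i j → trans (cong₂ (adj G) (sym (φ∘ψ i)) (sym (φ∘ψ j))) (φ-preserves (ψ i) (ψ j)) )

proposition2p3 : ∀ {n} (G : Graph n) (ν : ℕ) → IsMatchingNumber G ν →
                 m G ≤ 3 ^ ν × (m G ≡ 3 ^ ν ⇔ G ≅ sK₃∪tK₁ ν (n ∸ 3 * ν))
proposition2p3 {n} G _ ((M , M-matching , refl) , M-maximum) =
  upper-bound , mk⇔ extremal⇒≅ ≅⇒extremal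
  where
  open MaximumMatching G M M-matching M-maximum using (upper-bound)
  extremal⇒≅ : m G ≡ 3 ^ length M → G ≅ sK₃∪tK₁ (length M) (n ∸ 3 * length M)
  extremal⇒≅ extremal = FromTriangles.isomorphism (Extremal.triangles G M M-matching M-maximum extremal)
  ≅⇒extremal : G ≅ sK₃∪tK₁ (length M) (n ∸ 3 * length M) → m G ≡ 3 ^ length M
  ≅⇒extremal G≅ = ℕP.≤-antisym upper-bound
    (Triangles.lower-bound (pull-back {G = G} G≅ (Coordinates.decomposition (length M) (n ∸ 3 * length M))))
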